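{- Let $\mathcal{C}$ be a non-empty class of labelled graphs that is closed under isomorphism and under taking induced subgraphs, let $\mathcal{C}_n$ be the set of members of $\mathcal{C}$ with vertex set $\{1,\ldots,n\}$, and let $n\ge 1$. Fix an isomorphism-invariant preorder $\preceq$ on labelled graphs and a function $m$ assigning to each labelled graph $H$ a subset $m(H)\subseteq V(H)$. Then: (a) If $m$ satisfies (A) and (B) for all graphs $H$, then the call $\texttt{generate}(K_1,n)$ outputs exactly one member of each isomorphism class of $\mathcal{C}_n$. (b) Suppose $m$ satisfies (A) and (B) for all $H$ with $|V(H)|<n$, and satisfies (A$'$) for all $H$ with $|V(H)|=n$. Let $G_1,G_2$ be non-isomorphic members of $\mathcal{C}_n$ with the same reduced deck. Then the call $\texttt{generate}(K_1,n)$ outputs $G_1$ and $G_2$ (up to isomorphism) as children of the same non-empty set of parents.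
   Context: All graphs are simple and undirected; a labelled graph on $n$ vertices has vertex set $\{1,\ldots,n\}$. For $\phi\in S_n$ and a graph $G$ on $\{1,\ldots,n\}$, $G^\phi$ is the graph with an edge $i^\phi j^\phi$ for each edge $ij$ of $G$; $\operatorname{Aut}(G)=\{\phi\in S_n : G^\phi=G\}$ (literal equality). For a vertex $v$, the card $G-v$ is the unlabelled graph obtained by deleting $v$; the reduced deck of $G$ is the set (not multiset) of isomorphism types of its cards. For $W\subseteq V(G)$, $G[W]v$ denotes the graph obtained from $G$ by adding a new vertex $v$ (labelled $|V(G)|+1$) adjacent exactly to the vertices in $W$. Properties of $m$: (A) for each $H$, $m(H)$ is an orbit of $\operatorname{Aut}(H)$ on $V(H)$; (A$'$) for each $H$, $m(H)$ is the union of all orbits of $\operatorname{Aut}(H)$ consisting of vertices $v$ such that the card $H-v$ is maximal under $\preceq$ among all cards of $H$; (B) for each $H$ on $\{1,\ldots,n\}$ and each $\phi\in S_n$, $m(H^\phi)=m(H)^\phi$. Algorithm $\texttt{generate}(G,n)$: if $|V(G)|=n$, output $G$; otherwise, for each orbit $A$ of the action of $\operatorname{Aut}(G)$ on the set of subsets of $V(G)$, choose any $W\in A$, form $H:=G[W]v$, and if $H\in\mathcal{C}$ and $v\in m(H)$, call $\texttt{generate}(H,n)$. When $H=G[W]v$ is formed in this loop, $G$ is called a parent of $H$ and $H$ a child of $G$. -}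

module Defs where

open import Data.Bool.Base using (Bool; true; false)
open import Data.Nat.Base using (ℕ; zero; suc; pred; _≤_; _<_)
open import Data.Fin.Base using (Fin; zero; suc; fromℕ; punchIn)
open import Data.Fin.Subset using (Subset; _∈_)
open import Data.Fin.Permutation using (Permutation; Permutation′; _⟨$⟩ʳ_; _⟨$⟩ˡ_)
open import Data.Vec.Base using (lookup; tabulate)
open import Data.Maybe.Base using (Maybe; just; nothing)
import Data.Maybe.Base as Maybe
open import Data.List.Base using (List; []; _∷_; length; concatMap)
import Data.List.Base as List
open import Data.List.Relation.Unary.All using (All; []; _∷_)
open import Data.Product.Base using (Σ; ∃; _×_; _,_; proj₁; proj₂)
open import Data.Sum.Base using (_⊎_)
open import Relation.Nullary using (¬_)
open import Relation.Binary.PropositionalEquality using (_≡_; refl)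
open import Function.Bundles using (_⇔_)

-- Labelled simple graphs on the vertex set Fin k  (= {1,…,k})

record Graph (k : ℕ) : Set where
  field
    adj    : Fin k → Fin k → Bool
    sym    : ∀ x y → adj x y ≡ adj y x
    irrefl : ∀ x → adj x x ≡ false
open Graph public

_≐_ : ∀ {k} → Graph k → Graph k → Set
G ≐ H = ∀ x y → adj G x y ≡ adj H x y

_≅_ : ∀ {a b} → Graph a → Graph b → Set
_≅_ {a} {b} G H =
  Σ (Permutation a b) λ f → ∀ x y → adj H (f ⟨$⟩ʳ x) (f ⟨$⟩ʳ y) ≡ adj G x y

-- G^φ : edge φ(i)φ(j) for each edge ij of G
_^_ : ∀ {k} → Graph k → Permutation′ k → Graph k
adj    (G ^ φ) x y = adj G (φ ⟨$⟩ˡ x) (φ ⟨$⟩ˡ y)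
sym    (G ^ φ) x y = sym G _ _
irrefl (G ^ φ) x   = irrefl G _

IsAut : ∀ {k} → Graph k → Permutation′ k → Set
IsAut G φ = (G ^ φ) ≐ G

_^ˢ_ : ∀ {k} → Subset k → Permutation′ k → Subset k
W ^ˢ φ = tabulate λ u → lookup W (φ ⟨$⟩ˡ u)

InOrbit : ∀ {k} → Graph k → Fin k → Fin k → Set
InOrbit G v u = Σ (Permutation′ _) λ φ → IsAut G φ × (φ ⟨$⟩ʳ v ≡ u)

SameSubsetOrbit : ∀ {k} → Graph k → Subset k → Subset k → Set
SameSubsetOrbit G W W' = Σ (Permutation′ _) λ φ → IsAut G φ × (W ^ˢ φ ≡ W')

induced : ∀ {j k} → Graph k → (ι : Fin j → Fin k) → Graph j
adj    (induced G ι) x y = adj G (ι x) (ι y)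
sym    (induced G ι) x y = sym G _ _
irrefl (induced G ι) x   = irrefl G _

-- the card G - v (vertices relabelled order-preservingly)
card : ∀ {k} → Graph k → Fin k → Graph (pred k)
card {suc k} G v = induced G (punchIn v)

K₁ : Graph 1
adj    K₁ _ _ = false
sym    K₁ _ _ = refl
irrefl K₁ _   = refl

-- G[W]v : add a new vertex (the last one, labelled k+1) adjacent to W

-- nothing ↔ the last vertex fromℕ k ; just i ↔ old vertex i
last? : ∀ {k} → Fin (suc k) → Maybe (Fin k)
last? {zero}  zero    = nothing
last? {suc k} zero    = just zero
last? {suc k} (suc i) = Maybe.map suc (last? i)

extAdj : ∀ {k} → (Fin k → Fin k → Bool) → Subset k →
         Maybe (Fin k) → Maybe (Fin k) → Bool
extAdj A W (just i) (just j) = A i j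
extAdj A W (just i) nothing  = lookup W i
extAdj A W nothing  (just j) = lookup W j
extAdj A W nothing  nothing  = false

extAdj-sym : ∀ {k} (A : Fin k → Fin k → Bool) W →
             (∀ x y → A x y ≡ A y x) →
             ∀ x y → extAdj A W x y ≡ extAdj A W y x
extAdj-sym A W s (just i) (just j) = s i j
extAdj-sym A W s (just i) nothing  = refl
extAdj-sym A W s nothing  (just j) = refl
extAdj-sym A W s nothing  nothing  = refl

extAdj-irr : ∀ {k} (A : Fin k → Fin k → Bool) W →
             (∀ x → A x x ≡ false) → ∀ x → extAdj A W x x ≡ false
extAdj-irr A W r (just i) = r i
extAdj-irr A W r nothing  = refl

_[_]v : ∀ {k} → Graph k → Subset k → Graph (suc k)
adj    (G [ W ]v) x y = extAdj (adj G) W (last? x) (last? y)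
sym    (G [ W ]v) x y = extAdj-sym (adj G) W (sym G) (last? x) (last? y)
irrefl (G [ W ]v) x   = extAdj-irr (adj G) W (irrefl G) (last? x)

newVertex : ∀ k → Fin (suc k)
newVertex k = fromℕ k

GraphClass : Set₁
GraphClass = ∀ {k} → Graph k → Set

NonEmptyClass : GraphClass → Set
NonEmptyClass C = Σ ℕ λ k → 1 ≤ k × Σ (Graph k) C

IsoClosed : GraphClass → Set
IsoClosed C = ∀ {a b} {G : Graph a} {H : Graph b} → C G → G ≅ H → C H

InducedClosed : GraphClass → Set
InducedClosed C = ∀ {j k} (G : Graph k) (ι : Fin j → Fin k) →
  (∀ x y → ι x ≡ ι y → x ≡ y) → C G → C (induced G ι)

Rel : Set₁
Rel = ∀ {a b} → Graph a → Graph b → Set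

IsIsoInvariantPreorder : Rel → Set
IsIsoInvariantPreorder _⪯_ =
  (∀ {a} (G : Graph a) → G ⪯ G) ×
  (∀ {a b c} {G : Graph a} {H : Graph b} {K : Graph c} →
     G ⪯ H → H ⪯ K → G ⪯ K) ×
  (∀ {a b a' b'} {G : Graph a} {H : Graph b} {G' : Graph a'} {H' : Graph b'} →
     G ≅ G' → H ≅ H' → G ⪯ H → G' ⪯ H')

VertexMap : Set
VertexMap = ∀ {k} → Graph k → Subset k

-- m is a function of the labelled graph (its edge set)
WellDefined : VertexMap → Set
WellDefined m = ∀ {k} {G H : Graph k} → G ≐ H → m G ≡ m H

PropA : VertexMap → ∀ {k} → Graph k → Set
PropA m H = Σ (Fin _) λ v → ∀ u → (u ∈ m H) ⇔ InOrbit H v u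

PropB : VertexMap → ∀ {k} → Graph k → Set
PropB m H = ∀ φ → m (H ^ φ) ≡ (m H ^ˢ φ)

MaxCard : Rel → ∀ {k} → Graph k → Fin k → Set
MaxCard _⪯_ H v = ∀ u → card H v ⪯ card H u → card H u ⪯ card H v

PropA' : Rel → VertexMap → ∀ {k} → Graph k → Set
PropA' _⪯_ m H =
  ∀ v → (v ∈ m H) ⇔ (∀ u → InOrbit H v u → MaxCard _⪯_ H u)

SameReducedDeck : ∀ {k} → Graph k → Graph k → Set
SameReducedDeck G H =
  (∀ v → Σ (Fin _) λ u → card G v ≅ card H u) ×
  (∀ u → Σ (Fin _) λ v → card H u ≅ card G v)

-- The algorithm generate(G, n), modelled as the type of its possible
-- executions (the choice of orbit representatives is arbitrary).

Transversal : ∀ {k} → Graph k → List (Subset k) → Set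
Transversal G ws =
  (∀ W → Σ (Fin (length ws)) λ i → SameSubsetOrbit G (List.lookup ws i) W) ×
  (∀ i j → SameSubsetOrbit G (List.lookup ws i) (List.lookup ws j) → i ≡ j)

-- an output: the output graph together with the parent it was created
-- from (nothing if it is the root)
Output : ℕ → Set
Output n = Graph n × Maybe (Σ ℕ Graph)

module Algorithm (C : GraphClass) (m : VertexMap) (n : ℕ) where

  data Run : ∀ {k} → Graph k → Set
  data Branch {k} (G : Graph k) (W : Subset k) : Set

  data Run where
    done : {G : Graph n} → Run G
    loop : ∀ {k} {G : Graph k} → k < n → (ws : List (Subset k)) →
           Transversal G ws → All (Branch G) ws → Run G

  data Branch {k} G W where
    recurse : C (G [ W ]v) → newVertex k ∈ m (G [ W ]v) →
              Run (G [ W ]v) → Branch G W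
    skip    : ¬ (C (G [ W ]v) × newVertex k ∈ m (G [ W ]v)) → Branch G W

  outputs  : ∀ {k} {G : Graph k} → Maybe (Σ ℕ Graph) → Run G → List (Output n)
  outputsB : ∀ {k} {G : Graph k} (ws : List (Subset k)) →
             All (Branch G) ws → List (Output n)
  outputs {G = G} p done = (G , p) ∷ []
  outputs p (loop _ ws _ bs) = outputsB ws bs
  outputsB [] [] = []
  outputsB {k} {G} (W ∷ ws) (recurse _ _ r ∷ bs) =
    outputs (just (k , G)) r List.++ outputsB ws bs
  outputsB (W ∷ ws) (skip _ ∷ bs) = outputsB ws bs

  Outs : ∀ {k} {G : Graph k} → Run G → List (Output n)
  Outs = outputs nothing

data _≈ᴳ_ : Σ ℕ Graph → Σ ℕ Graph → Set where
  same : ∀ {j} {P Q : Graph j} → P ≐ Q → (j , P) ≈ᴳ (j , Q)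

ParentOf : ∀ {n} → List (Output n) → Graph n → Σ ℕ Graph → Set
ParentOf os G P =
  Σ (Fin (length os)) λ i →
    (proj₁ (List.lookup os i) ≅ G) ×
    Σ (Σ ℕ Graph) λ P' → (proj₂ (List.lookup os i) ≡ just P') × (P' ≈ᴳ P)

-- Every H in 𝒞 on n vertices reduces to K₁ by repeatedly deleting a vertex of m,
-- and generate retraces such a reduction: each step adds a vertex to a card X,
-- and the orbit representative W chosen by the loop of X gives an isomorphic
-- child. Under (A) the reduction is unique up to isomorphism, and two extensions
-- X[W]v, X[W′]v on the way to H are isomorphic by a map fixing the new vertex,
-- i.e. W and W′ lie in one Aut(X)-orbit, so H is output only once. For (b), on
-- n vertices (A′) only asks the new vertex to have a maximal card, and maximality
-- is read off the common reduced deck: every parent of G₁ is a parent of G₂.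

module Submission where

open import Defs
open import Data.Empty using (⊥; ⊥-elim)
open import Data.Fin.Base using (Fin; zero; suc; punchIn)
open import Data.Fin.Permutation as Perm
  using (Permutation; Permutation′; _⟨$⟩ʳ_; _⟨$⟩ˡ_; inverseˡ; inverseʳ; flip; _∘ₚ_;
         remove; insert)
open import Data.Fin.Properties using (_≟_; any?; 0≢1+n; suc-injective; punchIn-injective)
open import Data.Fin.Subset.Properties using (_∈?_)
open import Data.Fin.Subset using (Subset; _∈_)
open import Data.Maybe.Base using (nothing; just)
open import Data.Nat.Base using (ℕ; zero; suc; _≤_; _<_; z≤n; s≤s)
open import Data.Nat.Properties
  using (≤-refl; <⇒≤; m≤n⇒m≤1+n; 1+n≰n; <-irrefl; m≤n⇒m<n∨m≡n)
open import Data.Product.Base using (Σ; _×_; _,_; proj₁; proj₂)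
open import Data.Vec.Base using (tabulate)
import Data.Vec.Base as Vec
open import Data.Vec.Properties
  using (lookup∘tabulate; tabulate∘lookup; tabulate-cong; []=⇒lookup; lookup⇒[]=)
open import Data.List.Base using (List; []; _∷_; _++_; length; lookup)
open import Data.List.Membership.Propositional using (lose)
open import Data.List.Membership.Propositional.Properties using (∈-lookup)
open import Data.List.Relation.Unary.All using (All; []; _∷_)
import Data.List.Relation.Unary.All as All
import Data.List.Relation.Unary.All.Properties as All
open import Data.List.Relation.Unary.AllPairs using (AllPairs; []; _∷_)
import Data.List.Relation.Unary.AllPairs.Properties as AllPairs
open import Data.List.Relation.Unary.Any using (Any; here; there)
import Data.List.Relation.Unary.Any as Any
open import Data.List.Relation.Unary.Any.Properties using (lookup-index; ++⁺ˡ; ++⁺ʳ; ++⁻)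
open import Data.Sum.Base using (_⊎_; inj₁; inj₂)
import Data.Sum.Base as Sum
import Data.Product.Base as Prod
open import Relation.Binary.PropositionalEquality
  using (_≡_; refl; cong; cong₂; trans; subst; module ≡-Reasoning) renaming (sym to ≡-sym)
open import Relation.Nullary using (¬_; yes; no)
open import Relation.Nullary.Decidable using (decidable-stable; ¬¬-excluded-middle)
open import Relation.Nullary.Negation using (¬¬-map)
open import Relation.Nullary.Negation.Core using (DoubleNegation)
open import Function.Base using (id)
open import Function.Bundles using (Equivalence; _⇔_; mk⇔)

-- Isomorphisms of labelled graphs

-- _≅_ as a record, so that both graphs can be inferred from an isomorphism.
record _≃_ {a b} (G : Graph a) (H : Graph b) : Set where
  constructor iso
  field
    perm : Permutation a b
    homo : ∀ x y → adj H (perm ⟨$⟩ʳ x) (perm ⟨$⟩ʳ y) ≡ adj G x y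
open _≃_ public
infix 4 _≃_

≅⇒≃ : ∀ {a b} {G : Graph a} {H : Graph b} → G ≅ H → G ≃ H
≅⇒≃ (f , p) = iso f p

≃⇒≅ : ∀ {a b} {G : Graph a} {H : Graph b} → G ≃ H → G ≅ H
≃⇒≅ (iso f p) = f , p

≐⇒≃ : ∀ {k} {G H : Graph k} → G ≐ H → G ≃ H
≐⇒≃ e = iso Perm.id λ x y → ≡-sym (e x y)

≃-refl : ∀ {k} {G : Graph k} → G ≃ G
≃-refl = iso Perm.id λ _ _ → refl

≃-sym : ∀ {a b} {G : Graph a} {H : Graph b} → G ≃ H → H ≃ G
≃-sym {H = H} (iso f p) = iso (flip f) λ x y →
  trans (≡-sym (p (f ⟨$⟩ˡ x) (f ⟨$⟩ˡ y))) (cong₂ (adj H) (inverseʳ f) (inverseʳ f))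

≃-trans : ∀ {a b c} {G : Graph a} {H : Graph b} {K : Graph c} → G ≃ H → H ≃ K → G ≃ K
≃-trans (iso f p) (iso g q) = iso (f ∘ₚ g) λ x y → trans (q _ _) (p x y)

≃⇒≐^ : ∀ {k} {G H : Graph k} (f : G ≃ H) → H ≐ (G ^ perm f)
≃⇒≐^ {H = H} (iso f p) x y =
  trans (cong₂ (adj H) (≡-sym (inverseʳ f)) (≡-sym (inverseʳ f))) (p _ _)

≃⇒aut : ∀ {k} {G : Graph k} (f : G ≃ G) → IsAut G (perm f)
≃⇒aut f x y = ≡-sym (≃⇒≐^ f x y)

aut⇒≃ : ∀ {k} {G : Graph k} {φ : Permutation′ k} → IsAut G φ → G ≃ G
aut⇒≃ {G = G} {φ} a = iso φ λ x y →
  trans (≡-sym (a (φ ⟨$⟩ʳ x) (φ ⟨$⟩ʳ y))) (cong₂ (adj G) (inverseˡ φ) (inverseˡ φ))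

one-vertex-≃ : (G H : Graph 1) → G ≃ H
one-vertex-≃ G H = iso Perm.id λ { zero zero → trans (irrefl H zero) (≡-sym (irrefl G zero)) }

_⟨_⟩≃⟨_⟩_ : ∀ {a b} → Graph a → Fin a → Fin b → Graph b → Set
G ⟨ v ⟩≃⟨ w ⟩ H = Σ (G ≃ H) λ f → perm f ⟨$⟩ʳ v ≡ w

rooted-sym : ∀ {a b} {G : Graph a} {H : Graph b} {v w} →
             G ⟨ v ⟩≃⟨ w ⟩ H → H ⟨ w ⟩≃⟨ v ⟩ G
rooted-sym (f , refl) = ≃-sym f , inverseˡ (perm f)

rooted-trans : ∀ {a b c} {G : Graph a} {H : Graph b} {K : Graph c} {u v w} →
               G ⟨ u ⟩≃⟨ v ⟩ H → H ⟨ v ⟩≃⟨ w ⟩ K → G ⟨ u ⟩≃⟨ w ⟩ K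
rooted-trans (f , refl) (g , refl) = ≃-trans f g , refl

inOrbit-refl : ∀ {k} {H : Graph k} {v} → InOrbit H v v
inOrbit-refl = Perm.id , (λ _ _ → refl) , refl

inOrbit⇒rooted : ∀ {k} {H : Graph k} {v u} → InOrbit H v u → H ⟨ v ⟩≃⟨ u ⟩ H
inOrbit⇒rooted (φ , a , e) = aut⇒≃ {φ = φ} a , e

card-rooted : ∀ {a b} {G : Graph (suc a)} {H : Graph (suc b)} {v w} →
              G ⟨ v ⟩≃⟨ w ⟩ H → card G v ≃ card H w
card-rooted {G = G} {H} {v} (iso f p , refl) = iso (remove v f) λ x y →
  trans (≡-sym (cong₂ (adj H) (Perm.punchIn-permute f v x) (Perm.punchIn-permute f v y)))
        (p (punchIn v x) (punchIn v y))

card-≃ : ∀ {a b} {G : Graph (suc a)} {H : Graph (suc b)} (f : G ≃ H) v →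
         card G v ≃ card H (perm f ⟨$⟩ʳ v)
card-≃ f v = card-rooted (f , refl)

-- One-point extensions G[W]v

insert-root : ∀ {a b} (i : Fin (suc a)) (j : Fin (suc b)) (π : Permutation a b) →
              insert i j π ⟨$⟩ʳ i ≡ j
insert-root i j π with i ≟ i
... | yes _  = refl
... | no i≢i = ⊥-elim (i≢i refl)

old : ∀ {k} → Fin k → Fin (suc k)
old {k} = punchIn (newVertex k)

data ExtensionVertex {k} : Fin (suc k) → Set where
  isNew : ExtensionVertex (newVertex k)
  isOld : (i : Fin k) → ExtensionVertex (old i)

extensionVertex : ∀ {k} (a : Fin (suc k)) → ExtensionVertex a
extensionVertex {zero}  zero    = isNew
extensionVertex {suc k} zero    = isOld zero
extensionVertex {suc k} (suc a) with extensionVertex a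
... | isNew   = isNew
... | isOld i = isOld (suc i)

last?-new : ∀ k → last? (newVertex k) ≡ nothing
last?-new zero    = refl
last?-new (suc k) rewrite last?-new k = refl

last?-old : ∀ {k} (i : Fin k) → last? (old i) ≡ just i
last?-old {suc k} zero    = refl
last?-old {suc k} (suc i) rewrite last?-old i = refl

module _ {k} (X : Graph k) (W : Subset k) where

  adj-old-old : ∀ i j → adj (X [ W ]v) (old i) (old j) ≡ adj X i j
  adj-old-old i j rewrite last?-old i | last?-old j = refl

  adj-old-new : ∀ i → adj (X [ W ]v) (old i) (newVertex k) ≡ Vec.lookup W i
  adj-old-new i rewrite last?-old i | last?-new k = refl

  card-new : card (X [ W ]v) (newVertex k) ≃ X
  card-new = ≐⇒≃ adj-old-old

extension-≃ : ∀ {k} {X : Graph k} {W} {Y : Graph (suc k)} (g : Permutation′ (suc k)) →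
              (∀ i j → adj Y (g ⟨$⟩ʳ old i) (g ⟨$⟩ʳ old j) ≡ adj X i j) →
              (∀ i → adj Y (g ⟨$⟩ʳ old i) (g ⟨$⟩ʳ newVertex k) ≡ Vec.lookup W i) →
              X [ W ]v ≃ Y
extension-≃ {k} {X} {W} {Y} g old-old old-new = iso g homo′
  where
  homo′ : ∀ a b → adj Y (g ⟨$⟩ʳ a) (g ⟨$⟩ʳ b) ≡ adj (X [ W ]v) a b
  homo′ a b with extensionVertex a | extensionVertex b
  ... | isNew   | isNew   = trans (irrefl Y _) (≡-sym (irrefl (X [ W ]v) _))
  ... | isNew   | isOld j = trans (sym Y _ _)
    (trans (old-new j) (trans (≡-sym (adj-old-new X W j)) (sym (X [ W ]v) _ _)))
  ... | isOld i | isNew   = trans (old-new i) (≡-sym (adj-old-new X W i))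
  ... | isOld i | isOld j = trans (old-old i j) (≡-sym (adj-old-old X W i j))

card-extension : ∀ {k} {X : Graph k} {Y : Graph (suc k)} {u} → card Y u ≃ X →
                 Σ (Subset k) λ W → (X [ W ]v) ⟨ newVertex k ⟩≃⟨ u ⟩ Y
card-extension {k} {X} {Y} {u} ψ = W , extension-≃ g old-old old-new , g-new
  where
  f : Permutation′ k
  f = perm ψ
  W : Subset k
  W = tabulate λ x → adj Y u (punchIn u (f ⟨$⟩ˡ x))
  g : Permutation′ (suc k)
  g = insert (newVertex k) u (flip f)
  g-new : g ⟨$⟩ʳ newVertex k ≡ u
  g-new = insert-root (newVertex k) u (flip f)
  g-old : ∀ i → g ⟨$⟩ʳ old i ≡ punchIn u (f ⟨$⟩ˡ i)
  g-old = Perm.insert-punchIn (newVertex k) u (flip f)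
  old-old : ∀ i j → adj Y (g ⟨$⟩ʳ old i) (g ⟨$⟩ʳ old j) ≡ adj X i j
  old-old i j = trans (cong₂ (adj Y) (g-old i) (g-old j)) (homo (≃-sym ψ) i j)
  old-new : ∀ i → adj Y (g ⟨$⟩ʳ old i) (g ⟨$⟩ʳ newVertex k) ≡ Vec.lookup W i
  old-new i = trans (cong₂ (adj Y) (g-old i) g-new)
                    (trans (sym Y _ _) (≡-sym (lookup∘tabulate _ i)))

lookup-^ˢ : ∀ {k} (W : Subset k) (φ : Permutation′ k) i →
            Vec.lookup (W ^ˢ φ) (φ ⟨$⟩ʳ i) ≡ Vec.lookup W i
lookup-^ˢ W φ i = trans (lookup∘tabulate _ (φ ⟨$⟩ʳ i)) (cong (Vec.lookup W) (inverseˡ φ))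

sameOrbit⇒rooted : ∀ {k} {X : Graph k} {W W′} → SameSubsetOrbit X W W′ →
                   (X [ W ]v) ⟨ newVertex k ⟩≃⟨ newVertex k ⟩ (X [ W′ ]v)
sameOrbit⇒rooted {k} {X} {W} (φ , aut , refl) = extension-≃ h old-old old-new , h-new
  where
  h : Permutation′ (suc k)
  h = insert (newVertex k) (newVertex k) φ
  h-new : h ⟨$⟩ʳ newVertex k ≡ newVertex k
  h-new = insert-root (newVertex k) (newVertex k) φ
  h-old : ∀ i → h ⟨$⟩ʳ old i ≡ old (φ ⟨$⟩ʳ i)
  h-old = Perm.insert-punchIn (newVertex k) (newVertex k) φ
  old-old : ∀ i j → adj (X [ W ^ˢ φ ]v) (h ⟨$⟩ʳ old i) (h ⟨$⟩ʳ old j) ≡ adj X i j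
  old-old i j = trans (cong₂ (adj (X [ W ^ˢ φ ]v)) (h-old i) (h-old j))
                      (trans (adj-old-old X (W ^ˢ φ) _ _) (homo (aut⇒≃ {G = X} {φ} aut) i j))
  old-new : ∀ i → adj (X [ W ^ˢ φ ]v) (h ⟨$⟩ʳ old i) (h ⟨$⟩ʳ newVertex k) ≡ Vec.lookup W i
  old-new i = trans (cong₂ (adj (X [ W ^ˢ φ ]v)) (h-old i) h-new)
                    (trans (adj-old-new X (W ^ˢ φ) _) (lookup-^ˢ W φ i))

rooted⇒sameOrbit : ∀ {k} {X : Graph k} {W₁ W₂} →
                   (X [ W₁ ]v) ⟨ newVertex k ⟩≃⟨ newVertex k ⟩ (X [ W₂ ]v) →
                   SameSubsetOrbit X W₁ W₂
rooted⇒sameOrbit {k} {X} {W₁} {W₂} (iso h p , h-new) =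
  φ , ≃⇒aut {G = X} (iso φ φ-homo) , φ-moves-W
  where
  open ≡-Reasoning
  φ : Permutation′ k
  φ = remove (newVertex k) h
  h-old : ∀ j → h ⟨$⟩ʳ old j ≡ old (φ ⟨$⟩ʳ j)
  h-old j = trans (Perm.punchIn-permute h (newVertex k) j)
                  (cong (λ z → punchIn z (φ ⟨$⟩ʳ j)) h-new)
  φ-homo : ∀ a b → adj X (φ ⟨$⟩ʳ a) (φ ⟨$⟩ʳ b) ≡ adj X a b
  φ-homo a b = begin
    adj X (φ ⟨$⟩ʳ a) (φ ⟨$⟩ʳ b)                       ≡⟨ adj-old-old X W₂ _ _ ⟨
    adj (X [ W₂ ]v) (old (φ ⟨$⟩ʳ a)) (old (φ ⟨$⟩ʳ b)) ≡⟨ cong₂ (adj (X [ W₂ ]v)) (h-old a) (h-old b) ⟨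
    adj (X [ W₂ ]v) (h ⟨$⟩ʳ old a) (h ⟨$⟩ʳ old b)     ≡⟨ p _ _ ⟩
    adj (X [ W₁ ]v) (old a) (old b)                   ≡⟨ adj-old-old X W₁ a b ⟩
    adj X a b                                         ∎
  W-lookup : ∀ j → Vec.lookup W₂ (φ ⟨$⟩ʳ j) ≡ Vec.lookup W₁ j
  W-lookup j = begin
    Vec.lookup W₂ (φ ⟨$⟩ʳ j)                          ≡⟨ adj-old-new X W₂ _ ⟨
    adj (X [ W₂ ]v) (old (φ ⟨$⟩ʳ j)) (newVertex k)    ≡⟨ cong₂ (adj (X [ W₂ ]v)) (h-old j) h-new ⟨
    adj (X [ W₂ ]v) (h ⟨$⟩ʳ old j) (h ⟨$⟩ʳ newVertex k) ≡⟨ p _ _ ⟩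
    adj (X [ W₁ ]v) (old j) (newVertex k)             ≡⟨ adj-old-new X W₁ j ⟩
    Vec.lookup W₁ j                                   ∎
  φ-moves-W : W₁ ^ˢ φ ≡ W₂
  φ-moves-W = trans (tabulate-cong λ u → trans (≡-sym (W-lookup (φ ⟨$⟩ˡ u)))
                                               (cong (Vec.lookup W₂) (inverseʳ φ)))
                    (tabulate∘lookup W₂)

transversal-extension : ∀ {k} {X : Graph k} ws {Y : Graph (suc k)} {u} →
                        Transversal X ws → card Y u ≃ X →
                        Σ (Fin (length ws)) λ i → (X [ lookup ws i ]v) ⟨ newVertex k ⟩≃⟨ u ⟩ Y
transversal-extension _ (covers , _) ψ with card-extension ψ
... | W , g with covers W
...   | i , orb = i , rooted-trans (sameOrbit⇒rooted orb) g

-- Consequences of (A), (B) and (A′)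

Equivariant : VertexMap → ℕ → Set
Equivariant m k = ∀ {G H : Graph k} {v w} → G ⟨ v ⟩≃⟨ w ⟩ H → v ∈ m G → w ∈ m H

∈-^ˢ : ∀ {k} {S : Subset k} (φ : Permutation′ k) {v} → v ∈ S → φ ⟨$⟩ʳ v ∈ S ^ˢ φ
∈-^ˢ {S = S} φ {v} v∈S =
  lookup⇒[]= (φ ⟨$⟩ʳ v) (S ^ˢ φ) (trans (lookup-^ˢ S φ v) ([]=⇒lookup v∈S))

propB⇒equivariant : ∀ {m : VertexMap} {k} → WellDefined m → ((H : Graph k) → PropB m H) →
                    Equivariant m k
propB⇒equivariant wd B {G} (f , refl) v∈m =
  subst (_ ∈_) (≡-sym (trans (wd (≃⇒≐^ f)) (B G (perm f)))) (∈-^ˢ (perm f) v∈m)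

OneOrbit : VertexMap → ∀ {k} → Graph k → Set
OneOrbit m H = ∀ {v w} → v ∈ m H → w ∈ m H → H ⟨ v ⟩≃⟨ w ⟩ H

module _ {m : VertexMap} {k} {H : Graph k} (A : PropA m H) where

  propA⇒oneOrbit : OneOrbit m H
  propA⇒oneOrbit v∈m w∈m = rooted-trans (rooted-sym (from-v₀ v∈m)) (from-v₀ w∈m)
    where
    from-v₀ : ∀ {u} → u ∈ m H → H ⟨ proj₁ A ⟩≃⟨ u ⟩ H
    from-v₀ {u} u∈m = inOrbit⇒rooted (Equivalence.to (proj₂ A u) u∈m)

  propA⇒nonempty : Σ (Fin k) (_∈ m H)
  propA⇒nonempty = proj₁ A , Equivalence.from (proj₂ A (proj₁ A)) (inOrbit-refl {H = H})

¬¬-maximal : ∀ {j} (_≲_ : Fin (suc j) → Fin (suc j) → Set) →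
             (∀ i → i ≲ i) → (∀ {a b c} → a ≲ b → b ≲ c → a ≲ c) →
             DoubleNegation (Σ (Fin (suc j)) λ i → ∀ i′ → i ≲ i′ → i′ ≲ i)
¬¬-maximal {zero}  _≲_ ≲-refl ≲-trans none = none (zero , λ { zero _ → ≲-refl zero })
¬¬-maximal {suc j} _≲_ ≲-refl ≲-trans none =
  ¬¬-maximal (λ a b → suc a ≲ suc b) (λ i → ≲-refl (suc i)) ≲-trans λ (i , max) →
    ¬¬-excluded-middle λ where
      (yes i≲0) → none (zero , λ where
        zero    _     → ≲-refl zero
        (suc i′) 0≲i′ → ≲-trans (max i′ (≲-trans i≲0 0≲i′)) i≲0)
      (no i≴0)  → none (suc i , λ where
        zero     i≲0  → ⊥-elim (i≴0 i≲0)
        (suc i′) i≲i′ → max i′ i≲i′)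

module _ {_⪯_ : Rel} (pre : IsIsoInvariantPreorder _⪯_) where
  private
    ⪯-resp-≅ = proj₂ (proj₂ pre)

  maxCard-rooted : ∀ {a b} {G : Graph (suc a)} {H : Graph (suc b)} {v w} →
                   G ⟨ v ⟩≃⟨ w ⟩ H → MaxCard _⪯_ G v → MaxCard _⪯_ H w
  maxCard-rooted {G = G} {H} {v} {w} r@(f , _) max u w⪯u =
    ⪯-resp-≅ (≃⇒≅ u-card) (≃⇒≅ v-card)
             (max (perm f ⟨$⟩ˡ u)
                  (⪯-resp-≅ (≃⇒≅ (≃-sym v-card)) (≃⇒≅ (≃-sym u-card)) w⪯u))
    where
    v-card : card G v ≃ card H w
    v-card = card-rooted r
    u-card : card G (perm f ⟨$⟩ˡ u) ≃ card H u
    u-card = card-rooted (f , inverseʳ (perm f))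

  maxCard-deck : ∀ {k} {G₁ G₂ : Graph (suc k)} {v w} →
                 (∀ u → Σ (Fin (suc k)) λ u′ → card G₂ u ≅ card G₁ u′) →
                 MaxCard _⪯_ G₁ v → card G₁ v ≃ card G₂ w → MaxCard _⪯_ G₂ w
  maxCard-deck {G₁ = G₁} {G₂} deck max v≃w u w⪯u with deck u
  ... | u′ , u≅u′ = ⪯-resp-≅ (≃⇒≅ (≃-sym (≅⇒≃ {G = card G₂ u} {card G₁ u′} u≅u′)))
                             (≃⇒≅ v≃w)
                             (max u′ (⪯-resp-≅ (≃⇒≅ (≃-sym v≃w)) u≅u′ w⪯u))

  module _ {m : VertexMap} {k} (A′ : (H : Graph (suc k)) → PropA' _⪯_ m H) where

    ∈m⇒maxCard : ∀ {H : Graph (suc k)} {v} → v ∈ m H → MaxCard _⪯_ H v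
    ∈m⇒maxCard {H} {v} v∈m = Equivalence.to (A′ H v) v∈m v (inOrbit-refl {H = H})

    maxCard⇒∈m : ∀ {H : Graph (suc k)} {v} → MaxCard _⪯_ H v → v ∈ m H
    maxCard⇒∈m {H} max =
      Equivalence.from (A′ H _) λ u orb → maxCard-rooted (inOrbit⇒rooted {H = H} orb) max

    propA'⇒equivariant : Equivariant m (suc k)
    propA'⇒equivariant r v∈m = maxCard⇒∈m (maxCard-rooted r (∈m⇒maxCard v∈m))

    -- A maximal card exists only up to double negation (⪯ need not be
    -- decidable), but membership in m H is decidable, hence stable.
    propA'⇒nonempty : (H : Graph (suc k)) → Σ (Fin (suc k)) (_∈ m H)
    propA'⇒nonempty H = decidable-stable (any? (_∈? m H))
      (¬¬-map (λ (v , max) → v , maxCard⇒∈m max)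
              (¬¬-maximal (λ u v → card H u ⪯ card H v) (λ u → proj₁ pre (card H u))
                          (proj₁ (proj₂ pre))))

AtMostOne : ∀ {A : Set} → (A → Set) → List A → Set
AtMostOne P = AllPairs (λ x y → P x → P y → ⊥)

module _ {A : Set} {P : A → Set} where

  atMostOne-++ : ∀ {xs ys} → AtMostOne P xs → AtMostOne P ys →
                 (Any P xs → Any P ys → ⊥) → AtMostOne P (xs ++ ys)
  atMostOne-++ one-xs one-ys disjoint = AllPairs.++⁺ one-xs one-ys
    (All.tabulate λ x∈xs → All.tabulate λ y∈ys px py → disjoint (lose x∈xs px) (lose y∈ys py))

  atMostOne-index : ∀ {xs} → AtMostOne P xs → (p : Any P xs) →
                    ∀ i → P (lookup xs i) → i ≡ Any.index p
  atMostOne-index _           (here _)   zero    _  = refl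
  atMostOne-index (x∉xs ∷ _)  (here px)  (suc i) pi = ⊥-elim (All.lookup x∉xs (∈-lookup i) px pi)
  atMostOne-index (x∉xs ∷ _)  (there p)  zero    px =
    ⊥-elim (All.lookupWith (λ ¬p py → ¬p px py) x∉xs p)
  atMostOne-index (_ ∷ one)   (there p)  (suc i) pi = cong suc (atMostOne-index one p i pi)

-- Runs of generate

K₁∈C : ∀ {C : GraphClass} → NonEmptyClass C → IsoClosed C → InducedClosed C → C K₁
K₁∈C (suc k , _ , G , cG) iso-closed induced-closed =
  iso-closed (induced-closed G (λ _ → zero) (λ { zero zero _ → refl }) cG)
             (≃⇒≅ (one-vertex-≃ (induced G (λ _ → zero)) K₁))

ChildOf : ∀ {n} → Σ ℕ Graph → Graph n → Output n → Set
ChildOf P G o = (proj₁ o ≅ G) × Σ (Σ ℕ Graph) λ P′ → (proj₂ o ≡ just P′) × (P′ ≈ᴳ P)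

module _ {n} {os : List (Output n)} {G : Graph n} {P : Σ ℕ Graph} where

  parentOf⇒any : ParentOf os G P → Any (ChildOf P G) os
  parentOf⇒any (i , child) = lose (∈-lookup i) child

  any⇒parentOf : Any (ChildOf P G) os → ParentOf os G P
  any⇒parentOf a = Any.index a , lookup-index a

≈ᴳ-refl : (P : Σ ℕ Graph) → P ≈ᴳ P
≈ᴳ-refl _ = same λ _ _ → refl

module Generation (C : GraphClass) (iso-closed : IsoClosed C) (induced-closed : InducedClosed C)
                  (m : VertexMap) (n : ℕ) (equivariant : ∀ {j} → j ≤ n → Equivariant m j) where
  open Algorithm C m n

  -- X arises from H, up to isomorphism, by d successive deletions of a
  -- vertex in m: the chain of canonical parents of H.
  data Reduces : ∀ {j k} → ℕ → Graph j → Graph k → Set where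
    stop   : ∀ {j} {H X : Graph j} → H ≃ X → Reduces 0 H X
    delete : ∀ {d j k} {H : Graph (suc j)} {X : Graph k} (v : Fin (suc j)) →
             v ∈ m H → Reduces d (card H v) X → Reduces (suc d) H X

  _↠_ : ∀ {j k} → Graph j → Graph k → Set
  H ↠ X = Σ ℕ λ d → Reduces d H X

  reduces-≤ : ∀ {d j k} {H : Graph j} {X : Graph k} → Reduces d H X → k ≤ j
  reduces-≤ (stop _)       = ≤-refl
  reduces-≤ (delete _ _ r) = m≤n⇒m≤1+n (reduces-≤ r)

  reduces-≃ : ∀ {d j} {H X : Graph j} → Reduces d H X → H ≃ X
  reduces-≃ (stop f)       = f
  reduces-≃ (delete _ _ r) = ⊥-elim (1+n≰n (reduces-≤ r))

  reduces-C : ∀ {d j k} {H : Graph j} {X : Graph k} → C H → Reduces d H X → C X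
  reduces-C cH (stop f) = iso-closed cH (≃⇒≅ f)
  reduces-C {H = H} cH (delete v _ r) =
    reduces-C (induced-closed H (punchIn v) (punchIn-injective v) cH) r

  reduces-target : ∀ {d j k} {H : Graph j} {X X′ : Graph k} →
                   Reduces d H X → X ≃ X′ → Reduces d H X′
  reduces-target (stop f)         g = stop (≃-trans f g)
  reduces-target (delete v v∈m r) g = delete v v∈m (reduces-target r g)

  reduces-source : ∀ {d j k} {H H′ : Graph j} {X : Graph k} → j ≤ n →
                   H ≃ H′ → Reduces d H X → Reduces d H′ X
  reduces-source le f (stop g) = stop (≃-trans (≃-sym f) g)
  reduces-source le f (delete v v∈m r) =
    delete (perm f ⟨$⟩ʳ v) (equivariant le (f , refl) v∈m)
           (reduces-source (<⇒≤ le) (card-≃ f v) r)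

  last-step : ∀ {d j k} {H : Graph j} {X : Graph k} → Reduces (suc d) H X →
              Σ (Graph (suc k)) λ Y → Reduces d H Y ×
                Σ (Fin (suc k)) λ u → u ∈ m Y × card Y u ≃ X
  last-step {H = H} (delete v v∈m (stop f)) = H , stop ≃-refl , v , v∈m , f
  last-step (delete v v∈m r@(delete _ _ _)) with last-step r
  ... | Y , r-Y , last = Y , delete v v∈m r-Y , last

  NonemptyUpTo : Set
  NonemptyUpTo = ∀ {j} (H : Graph (suc (suc j))) → suc (suc j) ≤ n → Σ (Fin (suc (suc j))) (_∈ m H)

  reduces-to-K₁ : NonemptyUpTo → ∀ {j} (H : Graph (suc j)) → suc j ≤ n → Reduces j H K₁
  reduces-to-K₁ nonempty {zero}  H _ = stop (one-vertex-≃ H K₁)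
  reduces-to-K₁ nonempty {suc j} H le with nonempty H le
  ... | v , v∈m = delete v v∈m (reduces-to-K₁ nonempty (card H v) (<⇒≤ le))

  module _ (I : ∀ {k} → Graph k → Set)
           (I-step : ∀ {k} {X : Graph k} {W} → k < n → C (X [ W ]v) →
                     newVertex k ∈ m (X [ W ]v) → I X → I (X [ W ]v)) where
    mutual
      outputs-invariant : ∀ {k} {X : Graph k} (r : Run X) p → I X →
                          All (λ o → I (proj₁ o)) (outputs p r)
      outputs-invariant done              _ iX = iX ∷ []
      outputs-invariant (loop lt ws _ bs) _ iX = branches-invariant lt ws bs iX

      branches-invariant : ∀ {k} {X : Graph k} → k < n → ∀ ws (bs : All (Branch X) ws) → I X →
                           All (λ o → I (proj₁ o)) (outputsB ws bs)
      branches-invariant lt []       []                       iX = []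
      branches-invariant lt (_ ∷ ws) (recurse c new∈m r ∷ bs) iX =
        All.++⁺ (outputs-invariant r _ (I-step lt c new∈m iX)) (branches-invariant lt ws bs iX)
      branches-invariant lt (_ ∷ ws) (skip _ ∷ bs)             iX = branches-invariant lt ws bs iX

  outputs-in-C : ∀ {k} {X : Graph k} (r : Run X) p → C X → All (λ o → C (proj₁ o)) (outputs p r)
  outputs-in-C = outputs-invariant C (λ _ cX _ _ → cX)

  outputs-reduce : ∀ {k} {X : Graph k} (r : Run X) p → All (λ o → proj₁ o ↠ X) (outputs p r)
  outputs-reduce {X = X} r p = outputs-invariant (λ Y → Y ↠ X) extend r p (0 , stop ≃-refl)
    where
    extend : ∀ {k} {Y : Graph k} {W} → k < n → C (Y [ W ]v) →
             newVertex k ∈ m (Y [ W ]v) → Y ↠ X → (Y [ W ]v) ↠ X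
    extend lt _ new∈m (d , r) =
      suc d , delete _ new∈m (reduces-source (<⇒≤ lt) (≃-sym (card-new _ _)) r)

  output-reduces : ∀ {k} {X : Graph k} {H : Graph n} (r : Run X) p →
                   Any (λ o → proj₁ o ≃ H) (outputs p r) → H ↠ X
  output-reduces r p = All.lookupWith (λ (d , red) o≃H → d , reduces-source ≤-refl o≃H red)
                                      (outputs-reduce r p)

  any-at-branch : ∀ {k} {X : Graph k} {Q : Output n → Set} ws (bs : All (Branch X) ws) i →
                  C (X [ lookup ws i ]v) → newVertex k ∈ m (X [ lookup ws i ]v) →
                  ((r : Run (X [ lookup ws i ]v)) → Any Q (outputs (just (k , X)) r)) →
                  Any Q (outputsB ws bs)
  any-at-branch (_ ∷ _)  (recurse _ _ r ∷ _)   zero    _  _     found = ++⁺ˡ (found r)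
  any-at-branch (_ ∷ _)  (skip fails ∷ _)     zero    cX new∈m _     = ⊥-elim (fails (cX , new∈m))
  any-at-branch {k} {X} (_ ∷ ws) (recurse _ _ r ∷ bs) (suc i) cX new∈m found =
    ++⁺ʳ (outputs (just (k , X)) r) (any-at-branch ws bs i cX new∈m found)
  any-at-branch (_ ∷ ws) (skip _ ∷ bs)        (suc i) cX new∈m found =
    any-at-branch ws bs i cX new∈m found

  ChildIsoTo : Graph n → Output n → Set
  ChildIsoTo H o = proj₁ o ≃ H × Σ (Σ ℕ Graph) λ P → proj₂ o ≡ just P

  -- The recursion is on d: the run of the chosen branch is only reached
  -- through any-at-branch, so it is not visibly a structural subterm.
  child-in-loop : ∀ d {k} {X : Graph k} {H : Graph n} → k < n → ∀ ws → Transversal X ws →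
                  (bs : All (Branch X) ws) → C H → Reduces d H X → Any (ChildIsoTo H) (outputsB ws bs)
  child-in-loop zero    lt _  _ _  _  (stop _) = ⊥-elim (<-irrefl refl lt)
  child-in-loop (suc d) {k} {X} {H} lt ws t bs cH red with last-step red
  ... | Y , red-Y , u , u∈m , card≃X with transversal-extension ws t card≃X
  ...   | i , e = any-at-branch ws bs i (reduces-C cH red-i) (equivariant lt (rooted-sym e) u∈m) λ where
          done                  → here (≃-sym (reduces-≃ red-i) , _ , refl)
          (loop lt′ ws′ t′ bs′) → child-in-loop d lt′ ws′ t′ bs′ cH red-i
    where
    red-i : Reduces d H (X [ lookup ws i ]v)
    red-i = reduces-target red-Y (≃-sym (proj₁ e))

  branches-reduce : ∀ {k} {X : Graph k} {H : Graph n} ws (bs : All (Branch X) ws) →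
                    Any (λ o → proj₁ o ≃ H) (outputsB ws bs) →
                    Σ (Fin (length ws)) λ i →
                      newVertex k ∈ m (X [ lookup ws i ]v) × H ↠ (X [ lookup ws i ]v)
  branches-reduce {k} {X} (_ ∷ ws) (recurse _ new∈m r ∷ bs) a with ++⁻ (outputs (just (k , X)) r) a
  ... | inj₁ a′ = zero , new∈m , output-reduces r _ a′
  ... | inj₂ a′ with branches-reduce ws bs a′
  ...   | i , found = suc i , found
  branches-reduce (_ ∷ ws) (skip _ ∷ bs) a with branches-reduce ws bs a
  ... | i , found = suc i , found

  Distinct : ∀ {k} → Graph k → List (Subset k) → Set
  Distinct X ws = ∀ i j → SameSubsetOrbit X (lookup ws i) (lookup ws j) → i ≡ j

  distinct-tail : ∀ {k} {X : Graph k} {W ws} → Distinct X (W ∷ ws) → Distinct X ws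
  distinct-tail distinct i j orb = suc-injective (distinct (suc i) (suc j) orb)

  module Uniqueness (one-orbit : ∀ {j} (H : Graph (suc j)) → suc j ≤ n → OneOrbit m H) where

    reductions-≃ : ∀ {d d′ j k} {H : Graph j} {Y Y′ : Graph k} → j ≤ n →
                   Reduces d H Y → Reduces d′ H Y′ → Y ≃ Y′
    reductions-≃ le (stop f)         (stop f′)          = ≃-trans (≃-sym f) f′
    reductions-≃ le (stop _)         (delete _ _ r′)    = ⊥-elim (1+n≰n (reduces-≤ r′))
    reductions-≃ le (delete _ _ r)   (stop _)           = ⊥-elim (1+n≰n (reduces-≤ r))
    reductions-≃ {H = H} le (delete v v∈m r) (delete v′ v′∈m r′) =
      reductions-≃ (<⇒≤ le) r
        (reduces-source (<⇒≤ le) (card-rooted (rooted-sym (one-orbit H le v∈m v′∈m))) r′)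

    -- Both extensions are reductions of H of the same size, hence isomorphic;
    -- by (A) the isomorphism can be chosen to fix the new vertex, and it then
    -- restricts to an automorphism of X carrying W to W′.
    reductions⇒sameOrbit : ∀ {k} {X : Graph k} {W W′} {H : Graph n} → k < n →
                           newVertex k ∈ m (X [ W ]v) → newVertex k ∈ m (X [ W′ ]v) →
                           H ↠ (X [ W ]v) → H ↠ (X [ W′ ]v) → SameSubsetOrbit X W W′
    reductions⇒sameOrbit {X = X} {W} {W′} lt new∈m new∈m′ (_ , r) (_ , r′) =
      rooted⇒sameOrbit
        (rooted-trans (f , refl) (one-orbit _ lt (equivariant lt (f , refl) new∈m) new∈m′))
      where
      f : (X [ W ]v) ≃ (X [ W′ ]v)
      f = reductions-≃ ≤-refl r r′

    module _ (H : Graph n) where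

      mutual
        outputs-unique : ∀ {k} {X : Graph k} (r : Run X) p →
                         AtMostOne (λ o → proj₁ o ≃ H) (outputs p r)
        outputs-unique done                           _ = [] ∷ []
        outputs-unique (loop lt ws (_ , distinct) bs) _ = branches-unique lt ws bs distinct

        branches-unique : ∀ {k} {X : Graph k} → k < n → ∀ ws (bs : All (Branch X) ws) →
                          Distinct X ws → AtMostOne (λ o → proj₁ o ≃ H) (outputsB ws bs)
        branches-unique lt []       []                        _        = []
        branches-unique {X = X} lt (W ∷ ws) (recurse _ new∈m r ∷ bs) distinct =
          atMostOne-++ (outputs-unique r _)
                       (branches-unique lt ws bs (distinct-tail {X = X} {W} {ws} distinct)) disjoint
          where
          disjoint : Any _ (outputs _ r) → Any _ (outputsB ws bs) → ⊥
          disjoint a a′ with branches-reduce ws bs a′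
          ... | j , new∈m′ , red′ =
            0≢1+n (distinct zero (suc j)
                    (reductions⇒sameOrbit lt new∈m new∈m′ (output-reduces r _ a) red′))
        branches-unique {X = X} lt (W ∷ ws) (skip _ ∷ bs) distinct =
          branches-unique lt ws bs (distinct-tail {X = X} {W} {ws} distinct)

  module SameDeck {_⪯_ : Rel} (pre : IsIsoInvariantPreorder _⪯_)
                  (A′ : (H : Graph n) → PropA' _⪯_ m H)
                  (G₁ G₂ : Graph n) (cG₂ : C G₂) (deck : SameReducedDeck G₁ G₂)
                  (P : Σ ℕ Graph) where

    record HasChildG₁ {k} (X : Graph k) : Set where
      constructor hasChild
      field
        top    : suc k ≡ n
        W      : Subset k
        ext≅G₁ : (X [ W ]v) ≅ G₁
        new∈m  : newVertex k ∈ m (X [ W ]v)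
        parent : (k , X) ≈ᴳ P

    -- X is a maximal card of G₁, hence (same reduced deck) isomorphic to a
    -- maximal card of G₂; so the loop of X also generates G₂, from the
    -- representative of the corresponding orbit of subsets.
    childG₂ : ∀ {k} {X : Graph k} ws → Transversal X ws → (bs : All (Branch X) ws) →
              HasChildG₁ X → Any (ChildOf P G₂) (outputsB ws bs)
    childG₂ {k} {X} ws t bs (hasChild refl W ext≅G₁ new∈m parent) =
      any-at-branch ws bs i (iso-closed cG₂ (≃⇒≅ (≃-sym e))) new∈m-i λ where
        done           → here (≃⇒≅ e , _ , refl , parent)
        (loop lt _ _ _) → ⊥-elim (<-irrefl refl lt)
      where
      f : (X [ W ]v) ≃ G₁
      f = ≅⇒≃ ext≅G₁
      v₁ : Fin n
      v₁ = perm f ⟨$⟩ʳ newVertex k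
      w : Fin n
      w = proj₁ (proj₁ deck v₁)
      card₁≃card₂ : card G₁ v₁ ≃ card G₂ w
      card₁≃card₂ = ≅⇒≃ (proj₂ (proj₁ deck v₁))
      card₂≃X : card G₂ w ≃ X
      card₂≃X = ≃-trans (≃-sym card₁≃card₂) (≃-trans (≃-sym (card-≃ f _)) (card-new X W))
      extension : Σ (Fin (length ws)) λ i → (X [ lookup ws i ]v) ⟨ newVertex k ⟩≃⟨ w ⟩ G₂
      extension = transversal-extension ws t card₂≃X
      i : Fin (length ws)
      i = proj₁ extension
      rooted-e : (X [ lookup ws i ]v) ⟨ newVertex k ⟩≃⟨ w ⟩ G₂
      rooted-e = proj₂ extension
      e : (X [ lookup ws i ]v) ≃ G₂
      e = proj₁ rooted-e
      w-max : MaxCard _⪯_ G₂ w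
      w-max = maxCard-deck pre {G₁ = G₁} {G₂} (proj₂ deck)
                (maxCard-rooted pre (f , refl) (∈m⇒maxCard pre {m = m} A′ new∈m)) card₁≃card₂
      new∈m-i : newVertex k ∈ m (X [ lookup ws i ]v)
      new∈m-i = maxCard⇒∈m pre {m = m} A′ {H = X [ lookup ws i ]v}
                  (maxCard-rooted pre (rooted-sym rooted-e) w-max)

    mutual
      transfer-loop : ∀ {k} {X : Graph k} ws → Transversal X ws → (bs : All (Branch X) ws) →
                      Any (ChildOf P G₁) (outputsB ws bs) → Any (ChildOf P G₂) (outputsB ws bs)
      transfer-loop ws t bs a = Sum.[ childG₂ ws t bs , id ] (transfer-branches ws bs a)

      transfer-branches : ∀ {k} {X : Graph k} ws (bs : All (Branch X) ws) →
                          Any (ChildOf P G₁) (outputsB ws bs) →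
                          HasChildG₁ X ⊎ Any (ChildOf P G₂) (outputsB ws bs)
      transfer-branches {k} {X} (_ ∷ ws) (recurse _ new∈m r ∷ bs) a
        with ++⁻ (outputs (just (k , X)) r) a
      ... | inj₁ a′ = Sum.map₂ ++⁺ˡ (transfer-run r new∈m a′)
      ... | inj₂ a′ = Sum.map₂ (++⁺ʳ _) (transfer-branches ws bs a′)
      transfer-branches (_ ∷ ws) (skip _ ∷ bs) a = transfer-branches ws bs a

      transfer-run : ∀ {k} {X : Graph k} {W} (r : Run (X [ W ]v)) → newVertex k ∈ m (X [ W ]v) →
                     Any (ChildOf P G₁) (outputs (just (k , X)) r) →
                     HasChildG₁ X ⊎ Any (ChildOf P G₂) (outputs (just (k , X)) r)
      transfer-run {W = W} done new∈m (here (f , _ , refl , parent)) =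
        inj₁ (hasChild refl W f new∈m parent)
      transfer-run (loop _ ws t bs) _ a = inj₂ (transfer-loop ws t bs a)

    transfer : (run : Run K₁) → Any (ChildOf P G₁) (Outs run) → Any (ChildOf P G₂) (Outs run)
    transfer done             (here (_ , _ , () , _))
    transfer (loop _ ws t bs) a = transfer-loop ws t bs a

module _ (C : GraphClass) (m : VertexMap) (n : ℕ) where
  open Algorithm C m n

  OutputOnce : Run K₁ → Graph n → Set
  OutputOnce run G =
    Σ (Fin (length (Outs run))) λ i →
      (proj₁ (lookup (Outs run) i) ≅ G) × (∀ j → proj₁ (lookup (Outs run) j) ≅ G → j ≡ i)

  OutputsEachClassOnce : Run K₁ → Set
  OutputsEachClassOnce run =
    All (λ o → C (proj₁ o)) (Outs run) × ((G : Graph n) → C G → OutputOnce run G)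

  SameParents : Graph n → Graph n → Run K₁ → Set
  SameParents G₁ G₂ run =
    ((P : Σ ℕ Graph) → ParentOf (Outs run) G₁ P ⇔ ParentOf (Outs run) G₂ P) ×
    Σ (Σ ℕ Graph) λ P → ParentOf (Outs run) G₁ P

generates-each-class-once :
  ∀ {C : GraphClass} → NonEmptyClass C → IsoClosed C → InducedClosed C →
  ∀ {m : VertexMap} → WellDefined m → ∀ n →
  (∀ {k} (H : Graph k) → 1 ≤ k → PropA m H) → (∀ {k} (H : Graph k) → PropB m H) →
  (run : Algorithm.Run C m (suc n) K₁) → OutputsEachClassOnce C m (suc n) run
generates-each-class-once {C} nonempty iso-closed induced-closed {m} wd n A B run =
  outputs-in-C run nothing (K₁∈C nonempty iso-closed induced-closed) , once
  where
  open Algorithm C m (suc n)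
  open Generation C iso-closed induced-closed m (suc n) (λ _ → propB⇒equivariant {m = m} wd B)
  open Uniqueness (λ H _ → propA⇒oneOrbit {m = m} (A H (s≤s z≤n)))

  output : ∀ {G} → C G → (r : Run K₁) → Any (λ o → proj₁ o ≃ G) (Outs r)
  output {G} _  done             = here (one-vertex-≃ K₁ G)
  output {G} cG (loop lt ws t bs) = Any.map proj₁ (child-in-loop n lt ws t bs cG red)
    where
    red : Reduces n G K₁
    red = reduces-to-K₁ (λ H _ → propA⇒nonempty {m = m} (A H (s≤s z≤n))) G ≤-refl

  once : (G : Graph (suc n)) → C G → OutputOnce C m (suc n) run G
  once G cG = Any.index found , ≃⇒≅ (lookup-index found) ,
              λ j j≅G → atMostOne-index (outputs-unique G run nothing) found j (≅⇒≃ j≅G)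
    where
    found : Any (λ o → proj₁ o ≃ G) (Outs run)
    found = output cG run

same-parents :
  ∀ {C : GraphClass} → IsoClosed C → InducedClosed C →
  ∀ {_⪯_ : Rel} → IsIsoInvariantPreorder _⪯_ → ∀ {m : VertexMap} → WellDefined m → ∀ n →
  (∀ {k} (H : Graph k) → 1 ≤ k → k < suc n → PropA m H) →
  (∀ {k} (H : Graph k) → k < suc n → PropB m H) →
  ((H : Graph (suc n)) → PropA' _⪯_ m H) →
  (G₁ G₂ : Graph (suc n)) → C G₁ → C G₂ → ¬ (G₁ ≅ G₂) → SameReducedDeck G₁ G₂ →
  (run : Algorithm.Run C m (suc n) K₁) → SameParents C m (suc n) G₁ G₂ run
same-parents {C} iso-closed induced-closed pre {m} wd n A B A′ G₁ G₂ cG₁ cG₂ G₁≇G₂ deck run =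
  (λ P → mk⇔ (transfer-parent {G₁} {G₂} {P} cG₂ deck)
             (transfer-parent {G₂} {G₁} {P} cG₁ (Prod.swap deck))) ,
  some-parent run
  where
  open Algorithm C m (suc n)

  equivariant : ∀ {j} → j ≤ suc n → Equivariant m j
  equivariant le with m≤n⇒m<n∨m≡n le
  ... | inj₁ lt   = propB⇒equivariant {m = m} wd (λ H → B H lt)
  ... | inj₂ refl = propA'⇒equivariant pre {m = m} A′

  open Generation C iso-closed induced-closed m (suc n) equivariant

  nonempty : NonemptyUpTo
  nonempty H le with m≤n⇒m<n∨m≡n le
  ... | inj₁ lt   = propA⇒nonempty {m = m} (A H (s≤s z≤n) lt)
  ... | inj₂ refl = propA'⇒nonempty pre {m = m} A′ H

  transfer-parent : ∀ {G G′ P} → C G′ → SameReducedDeck G G′ →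
                    ParentOf (Outs run) G P → ParentOf (Outs run) G′ P
  transfer-parent {G} {G′} {P} cG′ deck′ parent =
    any⇒parentOf {G = G′}
      (SameDeck.transfer pre A′ G G′ cG′ deck′ P run (parentOf⇒any {G = G} parent))

  some-parent : (r : Run K₁) → Σ (Σ ℕ Graph) (ParentOf (Outs r) G₁)
  some-parent done              = ⊥-elim (G₁≇G₂ (≃⇒≅ (one-vertex-≃ G₁ G₂)))
  some-parent (loop lt ws t bs)
    with child-in-loop n lt ws t bs cG₁ (reduces-to-K₁ nonempty G₁ ≤-refl)
  ... | found with lookup-index found
  ...   | G₁≃ , P , parent = P , Any.index found , ≃⇒≅ G₁≃ , P , parent , ≈ᴳ-refl P

theorem1 :
    (C : GraphClass) → NonEmptyClass C → IsoClosed C → InducedClosed C →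
    (_⪯_ : Rel) → IsIsoInvariantPreorder _⪯_ →
    (m : VertexMap) → WellDefined m →
    (n : ℕ) → 1 ≤ n →
    -- (a)
    ((∀ {k} (H : Graph k) → 1 ≤ k → PropA m H) →
     (∀ {k} (H : Graph k) → PropB m H) →
     (run : Algorithm.Run C m n K₁) →
     All (λ o → C (proj₁ o)) (Algorithm.Outs C m n run) ×
     ((G : Graph n) → C G →
       Σ (Fin (length (Algorithm.Outs C m n run))) λ i →
         (proj₁ (lookup (Algorithm.Outs C m n run) i) ≅ G) ×
         (∀ j → proj₁ (lookup (Algorithm.Outs C m n run) j) ≅ G → j ≡ i)))
    ×
    -- (b)
    ((∀ {k} (H : Graph k) → 1 ≤ k → k < n → PropA m H) →
     (∀ {k} (H : Graph k) → k < n → PropB m H) →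
     ((H : Graph n) → PropA' _⪯_ m H) →
     (G₁ G₂ : Graph n) → C G₁ → C G₂ → ¬ (G₁ ≅ G₂) →
     SameReducedDeck G₁ G₂ →
     (run : Algorithm.Run C m n K₁) →
     ((P : Σ ℕ Graph) →
        ParentOf (Algorithm.Outs C m n run) G₁ P ⇔
        ParentOf (Algorithm.Outs C m n run) G₂ P) ×
     Σ (Σ ℕ Graph) λ P → ParentOf (Algorithm.Outs C m n run) G₁ P)
theorem1 C nonempty iso-closed induced-closed _⪯_ pre m wd (suc n) (s≤s z≤n) =
  generates-each-class-once nonempty iso-closed induced-closed wd n ,
  same-parents iso-closed induced-closed pre wd n
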